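{- Let $p\ge 3$ be an integer, $t=2p-2$, let $G$ be a simple undirected graph in which every vertex has degree at most $t+1$, and let $w$ be a real edge-weight function that is vertex-induced on every $K^p_2$ of $G$. Then $w$ is vertex-induced on every dense subgraph $H$ of $G$; moreover, a potential function of any $K^p_2$ contained in $H$ is also a potential function of $H$.
   Context: $K^p_2$ is the complete $p$-partite graph with $p$ color classes of $2$ vertices each; a "$K^p_2$ of $G$" is a subgraph of $G$ (not necessarily induced) isomorphic to it. For $A\subseteq V(G)$ with $|A|=2p$, $G[A]$ is dense if it contains at least two different $K^p_2$'s. $w$ is vertex-induced on a subgraph $H$ if there is $r_H:V(H)\to\mathbb{R}$ (a potential function of $H$) with $w(u,v)=r_H(u)+r_H(v)$ for every edge $(u,v)$ of $H$. -}

module Defs where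

open import Level using (Level; _⊔_) renaming (suc to lsuc)
open import Algebra.Bundles using (CommutativeRing)
open import Data.Nat using (ℕ; zero; suc)
import Data.Nat as N
open import Data.Bool using (Bool; true; false; if_then_else_)
open import Data.Fin using (Fin)
open import Data.Fin.Subset using (Subset; _∈_; ∣_∣)
open import Data.List using (List; map; allFin)
open import Data.Nat.ListAction using (sum)
open import Data.Product using (Σ; ∃; _×_; _,_)
open import Relation.Nullary using (¬_)
open import Relation.Binary.PropositionalEquality using (_≡_; _≢_)
open import Function.Definitions using (Injective)

-- Fields of characteristic zero (the real numbers are one; stdlib has no ℝ).

ι : ∀ {c ℓ} (R : CommutativeRing c ℓ) → ℕ → CommutativeRing.Carrier R
ι R zero    = CommutativeRing.0# R
ι R (suc n) = CommutativeRing._+_ R (CommutativeRing.1# R) (ι R n)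

record CharZeroField (c ℓ : Level) : Set (lsuc (c ⊔ ℓ)) where
  field
    commRing : CommutativeRing c ℓ
  open CommutativeRing commRing public
  field
    1≉0      : ¬ (1# ≈ 0#)
    inverse  : ∀ x → ¬ (x ≈ 0#) → Σ Carrier (λ y → x * y ≈ 1#)
    charZero : ∀ n → ¬ (ι commRing (suc n) ≈ 0#)

record Graph (n : ℕ) : Set where
  field
    adj     : Fin n → Fin n → Bool
    adj-sym : ∀ u v → adj u v ≡ adj v u
    irrefl  : ∀ v → adj v v ≡ false
open Graph public

Adj : ∀ {n} → Graph n → Fin n → Fin n → Set
Adj G u v = adj G u v ≡ true

degree : ∀ {n} → Graph n → Fin n → ℕ
degree {n} G v = sum (map (λ u → if adj G v u then 1 else 0) (allFin n))

-- A K^p_2 of G: 2p distinct vertices f i a (i : Fin p a colour class,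
-- a : Fin 2 position in the class) such that vertices in different
-- classes are adjacent in G.  (Not necessarily induced.)

record K2 {n : ℕ} (G : Graph n) (p : ℕ) : Set where
  field
    emb   : Fin p × Fin 2 → Fin n
    inj   : Injective _≡_ _≡_ emb
    edges : ∀ i j a b → i ≢ j → Adj G (emb (i , a)) (emb (j , b))
open K2 public

KEdge : ∀ {n p} {G : Graph n} → K2 G p → Fin n → Fin n → Set
KEdge {p = p} K u v =
  ∃ λ (i : Fin p) → ∃ λ (j : Fin p) → ∃ λ (a : Fin 2) → ∃ λ (b : Fin 2) →
    i ≢ j × emb K (i , a) ≡ u × emb K (j , b) ≡ v

KVertex : ∀ {n p} {G : Graph n} → K2 G p → Fin n → Set
KVertex {p = p} K u = ∃ λ (x : Fin p × Fin 2) → emb K x ≡ u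

SameSubgraph : ∀ {n p} {G : Graph n} → K2 G p → K2 G p → Set
SameSubgraph K L =
  (∀ u → (KVertex K u → KVertex L u) × (KVertex L u → KVertex K u)) ×
  (∀ u v → (KEdge K u v → KEdge L u v) × (KEdge L u v → KEdge K u v))

KIn : ∀ {n p} {G : Graph n} → K2 G p → Subset n → Set
KIn K A = ∀ u → KVertex K u → u ∈ A

Dense : ∀ {n} → Graph n → ℕ → Subset n → Set
Dense G p A = ∣ A ∣ ≡ N._*_ 2 p ×
  ∃ λ (K : K2 G p) → ∃ λ (L : K2 G p) → KIn K A × KIn L A × ¬ SameSubgraph K L

module _ {c ℓ : Level} (F : CharZeroField c ℓ) where
  open CharZeroField F

  IsPotentialK : ∀ {n p} {G : Graph n} → (Fin n → Fin n → Carrier) →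
                 K2 G p → (Fin n → Carrier) → Set ℓ
  IsPotentialK w K r = ∀ u v → KEdge K u v → w u v ≈ r u + r v

  IsPotentialInd : ∀ {n} → Graph n → (Fin n → Fin n → Carrier) →
                   Subset n → (Fin n → Carrier) → Set ℓ
  IsPotentialInd G w A r = ∀ u v → u ∈ A → v ∈ A → Adj G u v → w u v ≈ r u + r v

-- Since |A| = 2p, every K^p_2 inside G[A] spans A.  Fix such a K with potential r.  An edge
-- of G[A] either joins two classes of K, and then r fits it, or joins the two vertices of a
-- class i.  If another class j is also an edge, exchanging a vertex of class i with one of
-- class j yields a K^p_2 K′ in which that edge joins two classes.  For each vertex x of class
-- i, some triangle through x and a third class is a triangle of both K and K′, and the pairwise
-- sums on a triangle determine a potential (2 is invertible); so the potential of K′, which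
-- fits the edge, agrees with r on it.  If no other class is an edge, every non-adjacent pair of
-- A must lie in one class of any K^p_2 on A, which pins down its classes and hence its edges:
-- all K^p_2's of G[A] coincide, contradicting density.
module Submission where

open import Defs
open import Level using (Level)
open import Data.Nat using (ℕ; _+_; _*_; _∸_; _≤_; s≤s)
import Data.Nat.Properties as ℕₚ
open import Data.Bool.Base using (true)
open import Data.Bool.Properties using () renaming (_≟_ to _≟ᵇ_)
open import Data.Fin using (Fin; zero; suc; remQuot)
open import Data.Fin.Properties using (_≟_; any?; suc-injective; injective⇒≤; *↔×)
open import Data.Fin.Permutation.Components using (transpose; transpose-inverse)
open import Data.Fin.Subset using (Subset; _∈_; ∣_∣; _-_; inside; outside)
open import Data.Fin.Subset.Properties using (x∈p∧x≢y⇒x∈p-y; x∈p⇒∣p-x∣<∣p∣)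
open import Data.Vec.Base using (_∷_; here; there)
open import Data.Product using (Σ; ∃; _×_; _,_; proj₁; proj₂)
open import Data.Sum using (_⊎_; inj₁; inj₂; [_,_])
open import Function using (_∘_; id)
open import Function.Bundles using (Injection)
open import Function.Definitions using (Injective)
open import Function.Properties.Inverse using (↔⇒↣)
open import Relation.Nullary using (¬_; Dec; yes; no; contradiction)
open import Relation.Nullary.Decidable using (¬?; _×-dec_)
open import Relation.Binary.PropositionalEquality using (_≡_; _≢_; refl; sym; trans; cong; subst)
import Algebra.Properties.CommutativeSemigroup as CommutativeSemigroupProperties
import Algebra.Properties.Ring as RingProperties

other : Fin 2 → Fin 2
other zero       = suc zero
other (suc zero) = zero

≢other : ∀ a → a ≢ other a
≢other zero       ()
≢other (suc zero) ()

≢⇒≡other : ∀ {a b : Fin 2} → a ≢ b → b ≡ other a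
≢⇒≡other {zero}     {zero}     a≢b = contradiction refl a≢b
≢⇒≡other {zero}     {suc zero} _   = refl
≢⇒≡other {suc zero} {zero}     _   = refl
≢⇒≡other {suc zero} {suc zero} a≢b = contradiction refl a≢b

avoid-two : ∀ {p} → 3 ≤ p → (i j : Fin p) → ∃ λ k → k ≢ i × k ≢ j
avoid-two (s≤s (s≤s (s≤s _))) (suc _)       (suc _)       = zero , (λ ()) , (λ ())
avoid-two (s≤s (s≤s (s≤s _))) zero          zero          = suc zero , (λ ()) , (λ ())
avoid-two (s≤s (s≤s (s≤s _))) zero          (suc zero)    = suc (suc zero) , (λ ()) , (λ ())
avoid-two (s≤s (s≤s (s≤s _))) zero          (suc (suc _)) = suc zero , (λ ()) , (λ ())
avoid-two (s≤s (s≤s (s≤s _))) (suc zero)    zero          = suc (suc zero) , (λ ()) , (λ ())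
avoid-two (s≤s (s≤s (s≤s _))) (suc (suc _)) zero          = suc zero , (λ ()) , (λ ())

transpose-matchˡ : ∀ {p} (i j : Fin p) → transpose i j i ≡ j
transpose-matchˡ i j with i ≟ i
... | yes _   = refl
... | no i≢i  = contradiction refl i≢i

transpose-matchʳ : ∀ {p} (i j : Fin p) → transpose i j j ≡ i
transpose-matchʳ i j with j ≟ i
... | yes refl = refl
... | no _ with j ≟ j
...   | yes _   = refl
...   | no j≢j  = contradiction refl j≢j

transpose-moved : ∀ {p} (i j k : Fin p) → transpose i j k ≢ k →
                  transpose i j k ≡ i ⊎ transpose i j k ≡ j
transpose-moved i j k moved with k ≟ i
... | yes _ = inj₂ refl
... | no _ with k ≟ j
...   | yes _ = inj₁ refl
...   | no _  = contradiction refl moved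

transpose-injective : ∀ {p} (i j : Fin p) → Injective _≡_ _≡_ (transpose i j)
transpose-injective i j eq =
  trans (sym (transpose-inverse j i)) (trans (cong (transpose j i) eq) (transpose-inverse j i))

index : ∀ {n} (S : Subset n) {x} → x ∈ S → Fin ∣ S ∣
index (inside  ∷ S) here        = zero
index (inside  ∷ S) (there x∈S) = suc (index S x∈S)
index (outside ∷ S) (there x∈S) = index S x∈S

index-injective : ∀ {n} (S : Subset n) {x y} (x∈S : x ∈ S) (y∈S : y ∈ S) →
                  index S x∈S ≡ index S y∈S → x ≡ y
index-injective (inside  ∷ S) here        here        _  = refl
index-injective (inside  ∷ S) here        (there _)   ()
index-injective (inside  ∷ S) (there _)   here        ()
index-injective (inside  ∷ S) (there x∈S) (there y∈S) eq =
  cong suc (index-injective S x∈S y∈S (suc-injective eq))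
index-injective (outside ∷ S) (there x∈S) (there y∈S) eq =
  cong suc (index-injective S x∈S y∈S eq)

injective⇒≤∣S∣ : ∀ {m n} (S : Subset n) {f : Fin m → Fin n} →
                 Injective _≡_ _≡_ f → (∀ x → f x ∈ S) → m ≤ ∣ S ∣
injective⇒≤∣S∣ S f-inj f∈S = injective⇒≤ (f-inj ∘ index-injective S (f∈S _) (f∈S _))

injective⇒onto : ∀ {m n} (S : Subset n) {f : Fin m → Fin n} →
                 Injective _≡_ _≡_ f → (∀ x → f x ∈ S) → ∣ S ∣ ≤ m →
                 ∀ {u} → u ∈ S → ∃ λ x → f x ≡ u
injective⇒onto S {f} f-inj f∈S ∣S∣≤m {u} u∈S with any? (λ x → f x ≟ u)
... | yes hit  = hit
... | no  miss = contradiction (ℕₚ.≤-trans ∣S∣≤m (injective⇒≤∣S∣ (S - u) f-inj f∈S-u))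
                               (ℕₚ.<⇒≱ (x∈p⇒∣p-x∣<∣p∣ u∈S))
  where
  f∈S-u : ∀ x → f x ∈ S - u
  f∈S-u x = x∈p∧x≢y⇒x∈p-y (f∈S x) (miss ∘ (x ,_))

module _ {c ℓ : Level} (F : CharZeroField c ℓ) where
  open CharZeroField F hiding (refl)
    renaming (_+_ to _⊕_; _*_ to _⊛_; sym to ≈-sym; trans to ≈-trans; setoid to ≈-setoid)
  open CommutativeSemigroupProperties +-commutativeSemigroup using (semimedialˡ)
  open RingProperties ring using (+-cancelʳ)
  open import Relation.Binary.Reasoning.Setoid ≈-setoid

  ι2*x≈x+x : ∀ x → ι commRing 2 ⊛ x ≈ x ⊕ x
  ι2*x≈x+x x = begin
    (1# ⊕ (1# ⊕ 0#)) ⊛ x     ≈⟨ distribʳ x 1# (1# ⊕ 0#) ⟩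
    1# ⊛ x ⊕ (1# ⊕ 0#) ⊛ x   ≈⟨ +-cong (*-identityˡ x) (*-congʳ (+-identityʳ 1#)) ⟩
    x ⊕ 1# ⊛ x               ≈⟨ +-congˡ (*-identityˡ x) ⟩
    x ⊕ x                    ∎

  x+x-injective : ∀ {x y} → x ⊕ x ≈ y ⊕ y → x ≈ y
  x+x-injective {x} {y} x+x≈y+y with t , 2t≈1 ← inverse (ι commRing 2) (charZero 1) =
    ≈-trans (halve x) (≈-trans (*-congˡ x+x≈y+y) (≈-sym (halve y)))
    where
    halve : ∀ z → z ≈ t ⊛ (z ⊕ z)
    halve z = begin
      z                        ≈⟨ *-identityˡ z ⟨
      1# ⊛ z                   ≈⟨ *-congʳ 2t≈1 ⟨
      (ι commRing 2 ⊛ t) ⊛ z   ≈⟨ *-congʳ (*-comm _ t) ⟩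
      (t ⊛ ι commRing 2) ⊛ z   ≈⟨ *-assoc t _ z ⟩
      t ⊛ (ι commRing 2 ⊛ z)   ≈⟨ *-congˡ (ι2*x≈x+x z) ⟩
      t ⊛ (z ⊕ z)              ∎

  pairwise-sums-determine : ∀ {a b c a′ b′ c′} →
    a ⊕ b ≈ a′ ⊕ b′ → a ⊕ c ≈ a′ ⊕ c′ → b ⊕ c ≈ b′ ⊕ c′ → a ≈ a′
  pairwise-sums-determine {a} {b} {c} {a′} {b′} {c′} ab ac bc =
    x+x-injective (+-cancelʳ (b ⊕ c) (a ⊕ a) (a′ ⊕ a′) (begin
      (a ⊕ a) ⊕ (b ⊕ c)        ≈⟨ semimedialˡ a b c ⟩
      (a ⊕ b) ⊕ (a ⊕ c)        ≈⟨ +-cong ab ac ⟩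
      (a′ ⊕ b′) ⊕ (a′ ⊕ c′)    ≈⟨ semimedialˡ a′ b′ c′ ⟨
      (a′ ⊕ a′) ⊕ (b′ ⊕ c′)    ≈⟨ +-congˡ bc ⟨
      (a′ ⊕ a′) ⊕ (b ⊕ c)      ∎))

Adj-sym : ∀ {n} (G : Graph n) {u v} → Adj G u v → Adj G v u
Adj-sym G {u} {v} uv = trans (adj-sym G v u) uv

Adj⇒≢ : ∀ {n} (G : Graph n) {u v} → Adj G u v → u ≢ v
Adj⇒≢ G {u} uv refl = contradiction (trans (sym (irrefl G u)) uv) λ ()

module _ {n p : ℕ} {G : Graph n} where

  ClassAdj : K2 G p → Fin p → Set
  ClassAdj K m = Adj G (emb K (m , zero)) (emb K (m , suc zero))

  SameClass : K2 G p → Fin n → Fin n → Set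
  SameClass K u v = ∃ λ m → ∃ λ a → ∃ λ b → emb K (m , a) ≡ u × emb K (m , b) ≡ v

  Triangle : K2 G p → Fin n → Fin n → Fin n → Set
  Triangle K x y z = KEdge K x y × KEdge K x z × KEdge K y z

  module _ (K : K2 G p) where

    classAdj? : ∀ m → Dec (ClassAdj K m)
    classAdj? m = adj G (emb K (m , zero)) (emb K (m , suc zero)) ≟ᵇ true

    Adj⇒ClassAdj : ∀ {m a b} → Adj G (emb K (m , a)) (emb K (m , b)) → ClassAdj K m
    Adj⇒ClassAdj {a = zero}     {zero}     uv = contradiction refl (Adj⇒≢ G uv)
    Adj⇒ClassAdj {a = zero}     {suc zero} uv = uv
    Adj⇒ClassAdj {a = suc zero} {zero}     uv = Adj-sym G uv
    Adj⇒ClassAdj {a = suc zero} {suc zero} uv = contradiction refl (Adj⇒≢ G uv)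

    emb-≢-other : ∀ {m a} → emb K (m , a) ≢ emb K (m , other a)
    emb-≢-other {a = a} = ≢other a ∘ cong proj₂ ∘ inj K

    KEdge⇒Adj : ∀ {u v} → KEdge K u v → Adj G u v
    KEdge⇒Adj (i , j , a , b , i≢j , refl , refl) = edges K i j a b i≢j

    KEdge⇒KVertices : ∀ {u v} → KEdge K u v → KVertex K u × KVertex K v
    KEdge⇒KVertices (i , j , a , b , _ , eu , ev) = ((i , a) , eu) , ((j , b) , ev)

    triangle : ∀ P Q R {x y z} → proj₁ P ≢ proj₁ Q → proj₁ P ≢ proj₁ R → proj₁ Q ≢ proj₁ R →
               emb K P ≡ x → emb K Q ≡ y → emb K R ≡ z → Triangle K x y z
    triangle (m₁ , a₁) (m₂ , a₂) (m₃ , a₃) m₁≢m₂ m₁≢m₃ m₂≢m₃ ex ey ez =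
      (m₁ , m₂ , a₁ , a₂ , m₁≢m₂ , ex , ey) , (m₁ , m₃ , a₁ , a₃ , m₁≢m₃ , ex , ez) ,
      (m₂ , m₃ , a₂ , a₃ , m₂≢m₃ , ey , ez)

    sameClass-sym : ∀ {u v} → SameClass K u v → SameClass K v u
    sameClass-sym (m , a , b , eu , ev) = m , b , a , ev , eu

    sameClass⇒KVertex : ∀ {u v} → SameClass K u v → KVertex K u
    sameClass⇒KVertex (m , a , _ , eu , _) = (m , a) , eu

    partner : ∀ {u} → KVertex K u → ∃ λ v → u ≢ v × SameClass K u v
    partner ((m , a) , refl) = emb K (m , other a) , emb-≢-other , m , a , other a , refl , refl

    sameClass-unique : ∀ {u v x} → SameClass K u v → SameClass K u x → u ≢ v → u ≢ x → v ≡ x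
    sameClass-unique (m , a , b , refl , refl) (_ , _ , d , eu , refl) u≢v u≢x
      with refl ← inj K eu =
      cong (λ z → emb K (m , z))
           (trans (≢⇒≡other (u≢v ∘ cong (λ z → emb K (m , z))))
                  (sym (≢⇒≡other (u≢x ∘ cong (λ z → emb K (m , z))))))

    KEdge-or-sameClass : ∀ {u v} → KVertex K u → KVertex K v → KEdge K u v ⊎ SameClass K u v
    KEdge-or-sameClass ((m , a) , refl) ((m′ , b) , refl) with m ≟ m′
    ... | yes refl  = inj₂ (m , a , b , refl , refl)
    ... | no m≢m′   = inj₁ (m , m′ , a , b , m≢m′ , refl , refl)

    KEdge⇒¬sameClass : ∀ {u v} → KEdge K u v → ¬ SameClass K u v
    KEdge⇒¬sameClass (i , j , a , b , i≢j , refl , refl) (m , _ , _ , eu , ev) =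
      i≢j (trans (sym (cong proj₁ (inj K eu))) (cong proj₁ (inj K ev)))

    ¬Adj⇒sameClass : ∀ {u v} → KVertex K u → KVertex K v → ¬ Adj G u v → SameClass K u v
    ¬Adj⇒sameClass ku kv ¬uv =
      [ (λ kuv → contradiction (KEdge⇒Adj kuv) ¬uv) , id ] (KEdge-or-sameClass ku kv)

    KIn⇒KVertex : ∀ {A} → KIn K A → ∣ A ∣ ≡ 2 * p → ∀ {u} → u ∈ A → KVertex K u
    KIn⇒KVertex {A} K⊆A ∣A∣≡2p u∈A =
      let x , hit = injective⇒onto A (Injection.injective (↔⇒↣ (*↔× {p} {2})) ∘ inj K)
                                   (λ x → K⊆A _ (_ , refl))
                                   (ℕₚ.≤-reflexive (trans ∣A∣≡2p (ℕₚ.*-comm 2 p))) u∈A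
      in remQuot 2 x , hit

  sameSubgraph-sym : ∀ {K L : K2 G p} → SameSubgraph K L → SameSubgraph L K
  sameSubgraph-sym (V , E) =
    (λ u → proj₂ (V u) , proj₁ (V u)) , (λ u v → proj₂ (E u v) , proj₁ (E u v))

  sameSubgraph-trans : ∀ {K L M : K2 G p} → SameSubgraph K L → SameSubgraph L M → SameSubgraph K M
  sameSubgraph-trans (V₁ , E₁) (V₂ , E₂) =
    (λ u → proj₁ (V₂ u) ∘ proj₁ (V₁ u) , proj₂ (V₁ u) ∘ proj₂ (V₂ u)) ,
    (λ u v → proj₁ (E₂ u v) ∘ proj₁ (E₁ u v) , proj₂ (E₁ u v) ∘ proj₂ (E₂ u v))

  KEdge-transfer : ∀ K L → (∀ {u} → KVertex K u → KVertex L u) →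
                   (∀ {u v} → u ≢ v → SameClass L u v → SameClass K u v) →
                   ∀ {u v} → KEdge K u v → KEdge L u v
  KEdge-transfer K L K⊆L L⇒K kuv =
    let ku , kv = KEdge⇒KVertices K kuv
        ¬Lsame  = KEdge⇒¬sameClass K kuv ∘ L⇒K (Adj⇒≢ G (KEdge⇒Adj K kuv))
    in [ id , (λ Luv → contradiction Luv ¬Lsame) ] (KEdge-or-sameClass L (K⊆L ku) (K⊆L kv))

  sameClasses⇒sameSubgraph : ∀ K L →
    (∀ {u} → KVertex K u → KVertex L u) → (∀ {u} → KVertex L u → KVertex K u) →
    (∀ {u v} → u ≢ v → SameClass K u v → SameClass L u v) →
    (∀ {u v} → u ≢ v → SameClass L u v → SameClass K u v) →
    SameSubgraph K L
  sameClasses⇒sameSubgraph K L K⊆L L⊆K K⇒L L⇒K =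
    (λ _ → K⊆L , L⊆K) ,
    (λ _ _ → KEdge-transfer K L K⊆L L⇒K , KEdge-transfer L K L⊆K K⇒L)

  module _ (K L : K2 G p)
           (K⊆L : ∀ {u} → KVertex K u → KVertex L u) (L⊆K : ∀ {u} → KVertex L u → KVertex K u)
           {i : Fin p} (others-nonadjacent : ∀ m → m ≢ i → ¬ ClassAdj K m) where

    private
      sameClass-L⇒K-off-i : ∀ {m a v} → m ≢ i → emb K (m , a) ≢ v →
                            SameClass L (emb K (m , a)) v → SameClass K (emb K (m , a)) v
      sameClass-L⇒K-off-i {m} {a} m≢i u≢v Luv =
        m , a , other a , refl , sym (sameClass-unique L Luv Luu′ u≢v (emb-≢-other K))
        where
        Luu′ : SameClass L (emb K (m , a)) (emb K (m , other a))
        Luu′ = ¬Adj⇒sameClass L (K⊆L (_ , refl)) (K⊆L (_ , refl))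
                              (others-nonadjacent m m≢i ∘ Adj⇒ClassAdj K)

      sameClass-L⇒K : ∀ {u v} → u ≢ v → SameClass L u v → SameClass K u v
      sameClass-L⇒K u≢v Luv
        with L⊆K (sameClass⇒KVertex L Luv) | L⊆K (sameClass⇒KVertex L (sameClass-sym L Luv))
      ... | (m , a) , refl | (m′ , b) , refl with m ≟ i | m′ ≟ i
      ... | no m≢i   | _        = sameClass-L⇒K-off-i m≢i u≢v Luv
      ... | yes _    | no m′≢i  =
        sameClass-sym K (sameClass-L⇒K-off-i m′≢i (u≢v ∘ sym) (sameClass-sym L Luv))
      ... | yes refl | yes refl = i , a , b , refl , refl

      sameClass-K⇒L : ∀ {u v} → u ≢ v → SameClass K u v → SameClass L u v
      sameClass-K⇒L u≢v Kuv with partner L (K⊆L (sameClass⇒KVertex K Kuv))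
      ... | u′ , u≢u′ , Luu′ =
        subst (SameClass L _) (sym (sameClass-unique K Kuv (sameClass-L⇒K u≢u′ Luu′) u≢v u≢u′)) Luu′

    nonadjacent-classes⇒sameSubgraph : SameSubgraph K L
    nonadjacent-classes⇒sameSubgraph =
      sameClasses⇒sameSubgraph K L K⊆L L⊆K sameClass-K⇒L sameClass-L⇒K

  module _ (K : K2 G p) {i j : Fin p} (i≢j : i ≢ j) (adjᵢ : ClassAdj K i) (adjⱼ : ClassAdj K j) where

    private
      π : Fin p → Fin p
      π = transpose i j

      -- class i becomes {K (i,0), K (j,1)} and class j becomes {K (j,0), K (i,1)}
      emb′ : Fin p × Fin 2 → Fin n
      emb′ (m , zero)     = emb K (m , zero)
      emb′ (m , suc zero) = emb K (π m , suc zero)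

      emb′-injective : Injective _≡_ _≡_ emb′
      emb′-injective {_ , zero}     {_ , zero}     eq = inj K eq
      emb′-injective {_ , suc zero} {_ , suc zero} eq =
        cong (_, suc zero) (transpose-injective i j (cong proj₁ (inj K eq)))
      emb′-injective {_ , zero}     {_ , suc zero} eq with () ← cong proj₂ (inj K eq)
      emb′-injective {_ , suc zero} {_ , zero}     eq with () ← cong proj₂ (inj K eq)

      adjacent-across : ∀ m m′ → m ≢ m′ → Adj G (emb K (m , zero)) (emb K (π m′ , suc zero))
      adjacent-across m m′ m≢m′ with m ≟ π m′
      ... | no m≢πm′ = edges K m (π m′) zero (suc zero) m≢πm′
      ... | yes refl with transpose-moved i j m′ m≢m′
      ...   | inj₁ πm′≡i = subst (ClassAdj K) (sym πm′≡i) adjᵢ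
      ...   | inj₂ πm′≡j = subst (ClassAdj K) (sym πm′≡j) adjⱼ

      emb′-edges : ∀ m m′ a b → m ≢ m′ → Adj G (emb′ (m , a)) (emb′ (m′ , b))
      emb′-edges m m′ zero       zero       m≢m′ = edges K m m′ zero zero m≢m′
      emb′-edges m m′ zero       (suc zero) m≢m′ = adjacent-across m m′ m≢m′
      emb′-edges m m′ (suc zero) zero       m≢m′ = Adj-sym G (adjacent-across m′ m (m≢m′ ∘ sym))
      emb′-edges m m′ (suc zero) (suc zero) m≢m′ =
        edges K (π m) (π m′) (suc zero) (suc zero) (m≢m′ ∘ transpose-injective i j)

    exchanged : K2 G p
    exchanged = record { emb = emb′ ; inj = emb′-injective ; edges = emb′-edges }

module _ {c ℓ : Level} (F : CharZeroField c ℓ) {n p : ℕ} {G : Graph n}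
         (w : Fin n → Fin n → CharZeroField.Carrier F) where
  open CharZeroField F using (_≈_; +-cong) renaming (_+_ to _⊕_; sym to ≈-sym; trans to ≈-trans)

  potentials-agree-on-triangle : ∀ (K L : K2 G p) {r s x y z} →
    IsPotentialK F w K r → IsPotentialK F w L s → Triangle K x y z → Triangle L x y z → r x ≈ s x
  potentials-agree-on-triangle K L {r} {s} rK sL (kxy , kxz , kyz) (lxy , lxz , lyz) =
    pairwise-sums-determine F (via kxy lxy) (via kxz lxz) (via kyz lyz)
    where
    via : ∀ {u v} → KEdge K u v → KEdge L u v → r u ⊕ r v ≈ s u ⊕ s v
    via k l = ≈-trans (≈-sym (rK _ _ k)) (sL _ _ l)

  exchanged-potential-fits-class :
    3 ≤ p → (K : K2 G p) {i j : Fin p} (i≢j : i ≢ j) (adjᵢ : ClassAdj K i) (adjⱼ : ClassAdj K j) →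
    ∀ {r s} → IsPotentialK F w K r → IsPotentialK F w (exchanged K i≢j adjᵢ adjⱼ) s →
    ∀ {a b} → a ≢ b → w (emb K (i , a)) (emb K (i , b)) ≈ r (emb K (i , a)) ⊕ r (emb K (i , b))
  exchanged-potential-fits-class p≥3 K {i} {j} i≢j adjᵢ adjⱼ {r} {s} rK sK′ {a} {b} a≢b
    with k , k≢i , k≢j ← avoid-two p≥3 i j =
    ≈-trans (sK′ _ _ (split a≢b)) (+-cong (≈-sym (agree a)) (≈-sym (agree b)))
    where
    K′ = exchanged K i≢j adjᵢ adjⱼ

    j1↦i1 : emb K′ (j , suc zero) ≡ emb K (i , suc zero)
    j1↦i1 = cong (λ m → emb K (m , suc zero)) (transpose-matchʳ i j)

    i1↦j1 : emb K′ (i , suc zero) ≡ emb K (j , suc zero)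
    i1↦j1 = cong (λ m → emb K (m , suc zero)) (transpose-matchˡ i j)

    agree : ∀ a → r (emb K (i , a)) ≈ s (emb K (i , a))
    agree zero = potentials-agree-on-triangle K K′ rK sK′
      (triangle K  (i , zero) (k , zero) (j , zero) (k≢i ∘ sym) i≢j k≢j refl refl refl)
      (triangle K′ (i , zero) (k , zero) (j , zero) (k≢i ∘ sym) i≢j k≢j refl refl refl)
    agree (suc zero) = potentials-agree-on-triangle K K′ rK sK′
      (triangle K  (i , suc zero) (k , zero) (j , suc zero) (k≢i ∘ sym) i≢j k≢j refl refl refl)
      (triangle K′ (j , suc zero) (k , zero) (i , suc zero) (k≢j ∘ sym) (i≢j ∘ sym) k≢i
                j1↦i1 refl i1↦j1)

    split : ∀ {a b} → a ≢ b → KEdge K′ (emb K (i , a)) (emb K (i , b))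
    split {zero}     {zero}     a≢b = contradiction refl a≢b
    split {zero}     {suc zero} _   = i , j , zero , suc zero , i≢j , refl , j1↦i1
    split {suc zero} {zero}     _   = j , i , suc zero , zero , i≢j ∘ sym , j1↦i1 , refl
    split {suc zero} {suc zero} a≢b = contradiction refl a≢b

module _ {c ℓ : Level} (F : CharZeroField c ℓ) {n p : ℕ} (p≥3 : 3 ≤ p) {G : Graph n}
         (w : Fin n → Fin n → CharZeroField.Carrier F)
         (pot : ∀ (K : K2 G p) → Σ (Fin n → CharZeroField.Carrier F) (IsPotentialK F w K))
         {A : Subset n} (∣A∣≡2p : ∣ A ∣ ≡ 2 * p) where

  potential-extends : (K : K2 G p) → KIn K A → ¬ (∀ L → KIn L A → SameSubgraph K L) →
                      ∀ r → IsPotentialK F w K r → IsPotentialInd F G w A r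
  potential-extends K K⊆A not-unique r rK u v u∈A v∈A uv
    with KEdge-or-sameClass K (KIn⇒KVertex K K⊆A ∣A∣≡2p u∈A) (KIn⇒KVertex K K⊆A ∣A∣≡2p v∈A)
  ... | inj₁ kuv = rK u v kuv
  ... | inj₂ (i , a , b , refl , refl) with any? (λ j → ¬? (j ≟ i) ×-dec classAdj? K j)
  ...   | yes (j , j≢i , adjⱼ) =
    let i≢j = j≢i ∘ sym
        adjᵢ = Adj⇒ClassAdj K uv
    in exchanged-potential-fits-class F w p≥3 K i≢j adjᵢ adjⱼ rK
         (proj₂ (pot (exchanged K i≢j adjᵢ adjⱼ))) (Adj⇒≢ G uv ∘ cong (λ z → emb K (i , z)))
  ...   | no none = contradiction unique not-unique
    where
    unique : ∀ L → KIn L A → SameSubgraph K L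
    unique L L⊆A = nonadjacent-classes⇒sameSubgraph K L
      (λ {u} → KIn⇒KVertex L L⊆A ∣A∣≡2p ∘ K⊆A u) (λ {u} → KIn⇒KVertex K K⊆A ∣A∣≡2p ∘ L⊆A u)
      (λ m m≢i adjₘ → none (m , m≢i , adjₘ))

lemma11 : {c ℓ : Level} (F : CharZeroField c ℓ) (n p : ℕ) → 3 ≤ p →
    (G : Graph n) →
    (∀ v → degree G v ≤ (2 * p ∸ 2) + 1) →
    (w : Fin n → Fin n → CharZeroField.Carrier F) →
    (∀ u v → Adj G u v → CharZeroField._≈_ F (w u v) (w v u)) →
    (∀ (K : K2 G p) → Σ (Fin n → CharZeroField.Carrier F) (IsPotentialK F w K)) →
    ∀ (A : Subset n) → Dense G p A →
      Σ (Fin n → CharZeroField.Carrier F) (IsPotentialInd F G w A)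
      × (∀ (K : K2 G p) → KIn K A → ∀ r → IsPotentialK F w K r → IsPotentialInd F G w A r)
lemma11 F n p p≥3 G _ w _ pot A (∣A∣≡2p , K₀ , L₀ , K₀⊆A , L₀⊆A , K₀≁L₀) =
  (proj₁ (pot K₀) , extends K₀ K₀⊆A (proj₁ (pot K₀)) (proj₂ (pot K₀))) , extends
  where
  extends : ∀ K → KIn K A → ∀ r → IsPotentialK F w K r → IsPotentialInd F G w A r
  extends K K⊆A = potential-extends F p≥3 w pot ∣A∣≡2p K K⊆A λ unique →
    K₀≁L₀ (sameSubgraph-trans {K = K₀} {L = K} {M = L₀}
             (sameSubgraph-sym {K = K} {L = K₀} (unique K₀ K₀⊆A)) (unique L₀ L₀⊆A))
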